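{- Let $U,W\subseteq V$ be two distinct deficient sets with $U\cap W\cap T\neq\emptyset$ and $U^*\cap W^*\cap T\ne\emptyset$. Then both $U\cap W$ and $U\cup W$ are deficient sets. Moreover, if $U$ or $W$ is a small deficient set, then $U\cap W$ is a small deficient set.
   Context: Let $G=(V,E)$ be a finite undirected graph, $T\subseteq V$ a set of terminals and $\ell\ge 0$ an integer. Standing assumptions: $T$ is $\ell$-connected in $G$ (every pair of distinct terminals is joined by $\ell$ openly disjoint paths, i.e. paths sharing only their endpoints), $|T|\ge 2\ell$, and no two terminals are adjacent in $G$. For $U\subseteq V$, let $N(U)=\{v\in V\setminus U:\exists u\in U,\ uv\in E\}$ and $U^*=V\setminus(U\cup N(U))$. A deficient set is a set $U\subseteq V$ with $U\cap T\ne\emptyset$, $U^*\cap T\neq\emptyset$ and $|N(U)|<\ell+1$ (equivalently $|N(U)|=\ell$). A deficient set $U$ is small if $|U\cap T|\le |U^*\cap T|$. -}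

module Defs where

open import Data.Nat using (ℕ; _<_; _≤_; suc)
open import Data.Bool using (Bool; true; false; not; _∧_; _∨_)
open import Data.Fin using (Fin)
open import Data.Fin.Subset using (Subset; _∈_; _∉_; _∩_; _∪_; ∁; ∣_∣; Nonempty)
open import Data.Vec using (Vec; tabulate; lookup)
open import Data.List using (List; []; _∷_; _++_; [_])
open import Data.List.Relation.Unary.Linked using (Linked)
open import Data.List.Relation.Unary.Unique.Propositional using (Unique)
import Data.List.Membership.Propositional as LM
open import Data.Product using (_×_; Σ; ∃)
open import Data.Empty using (⊥)
open import Relation.Binary.PropositionalEquality using (_≡_; _≢_)

record Graph (n : ℕ) : Set where
  field
    adj     : Fin n → Fin n → Bool
    adj-sym : ∀ u v → adj u v ≡ adj v u
    adj-irr : ∀ v → adj v v ≡ false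

open Graph public

module _ {n : ℕ} (G : Graph n) where

  Adjacent : Fin n → Fin n → Set
  Adjacent u v = adj G u v ≡ true

  anyAdj : ∀ {m} → (Fin m → Fin n) → Subset n → Fin n → Bool
  anyAdj {0} f U v = false
  anyAdj {suc m} f U v =
    (lookup U (f Fin.zero) ∧ adj G (f Fin.zero) v) ∨ anyAdj (λ i → f (Fin.suc i)) U v
    where import Data.Fin as Fin

  Nbh : Subset n → Subset n
  Nbh U = tabulate (λ v → not (lookup U v) ∧ anyAdj (λ i → i) U v)

  Star : Subset n → Subset n
  Star U = ∁ (U ∪ Nbh U)

  IsPath : Fin n → Fin n → List (Fin n) → Set
  IsPath s t xs = Linked Adjacent (s ∷ xs ++ [ t ]) × Unique (s ∷ xs ++ [ t ])

  -- ℓ openly disjoint s–t paths (given by their interiors), pairwise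
  -- sharing no internal vertex.
  OpenlyDisjointPaths : ℕ → Fin n → Fin n → Set
  OpenlyDisjointPaths ℓ s t =
    Σ (Vec (List (Fin n)) ℓ) λ P →
      (∀ i → IsPath s t (lookup P i)) ×
      (∀ i j → i ≢ j → ∀ v → v LM.∈ lookup P i → v LM.∈ lookup P j → ⊥)

  Connected : Subset n → ℕ → Set
  Connected T ℓ = ∀ s t → s ∈ T → t ∈ T → s ≢ t → OpenlyDisjointPaths ℓ s t

  TerminalsIndependent : Subset n → Set
  TerminalsIndependent T = ∀ s t → s ∈ T → t ∈ T → adj G s t ≡ false

  Deficient : Subset n → ℕ → Subset n → Set
  Deficient T ℓ U =
    Nonempty (U ∩ T) × Nonempty (Star U ∩ T) × ∣ Nbh U ∣ < suc ℓ

  SmallDeficient : Subset n → ℕ → Subset n → Set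
  SmallDeficient T ℓ U = Deficient T ℓ U × ∣ U ∩ T ∣ ≤ ∣ Star U ∩ T ∣

-- Submodularity of neighbourhoods, |N(U ∩ W)| + |N(U ∪ W)| ≤ |N(U)| + |N(W)| ≤ 2ℓ,
-- together with Menger's bound: a terminal s inside X and a terminal t in X* are joined by
-- ℓ openly disjoint paths, each of which leaves X through its own vertex of N(X), so
-- |N(X)| ≥ ℓ for X = U ∩ W and X = U ∪ W. Hence both neighbourhoods have exactly ℓ
-- vertices. Smallness passes to U ∩ W because U ∩ W ⊆ U while U* ⊆ (U ∩ W)*.
module Submission where

open import Defs
open import Data.Nat using (ℕ; suc; _+_; _*_; _≤_; z≤n; s≤s)
open import Data.Nat.Properties using (+-suc; +-comm; +-cancelʳ-≤; +-monoʳ-≤; ≤-trans; ≤-pred; +-mono-≤)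
open import Data.Bool using (true; false; not; _∧_; _∨_)
open import Data.Bool.Properties using (∨-zeroʳ)
open import Data.Fin using (Fin; zero; suc; _≟_)
open import Data.Fin.Properties using (suc-injective)
open import Data.Fin.Subset using (Subset; _∈_; _∉_; _⊆_; _∩_; _∪_; _-_; ∣_∣; Nonempty; inside; outside)
open import Data.Fin.Subset.Properties
  using (x∈p∩q⁺; x∈p∩q⁻; x∈p∪q⁺; x∈p∪q⁻; p∩q⊆p; p∩q⊆q; p⊆p∪q; q⊆p∪q; p⊆q⇒∣p∣≤∣q∣;
         x∈∁p⇒x∉p; x∉p⇒x∈∁p; _∈?_; x∈p∧x≢y⇒x∈p-y; x∈p⇒∣p-x∣<∣p∣)
open import Data.Vec using ([]; _∷_; lookup)
open import Data.Vec.Properties using (lookup∘tabulate; []=⇒lookup; lookup⇒[]=)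
open import Data.List using ([]; _∷_; _++_; [_])
open import Data.List.Relation.Unary.Linked using (Linked; _∷_)
open import Data.List.Relation.Unary.Any using (here; there)
import Data.List.Membership.Propositional as List
open import Data.Product using (_×_; _,_; proj₁; proj₂; ∃)
open import Data.Sum using (_⊎_; inj₁; inj₂)
open import Function using (Injective; id; _∘_; case_of_)
open import Relation.Nullary using (¬_; yes; no; contradiction)
open import Relation.Nullary.Decidable using (decidable-stable)
open import Relation.Binary.PropositionalEquality using (_≡_; _≢_; refl; cong; sym; trans; subst; subst₂; module ≡-Reasoning)

∣p∩q∣+∣p∪q∣≡∣p∣+∣q∣ : ∀ {n} (p q : Subset n) → ∣ p ∩ q ∣ + ∣ p ∪ q ∣ ≡ ∣ p ∣ + ∣ q ∣
∣p∩q∣+∣p∪q∣≡∣p∣+∣q∣ []            []            = refl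
∣p∩q∣+∣p∪q∣≡∣p∣+∣q∣ (outside ∷ p) (outside ∷ q) = ∣p∩q∣+∣p∪q∣≡∣p∣+∣q∣ p q
∣p∩q∣+∣p∪q∣≡∣p∣+∣q∣ (outside ∷ p) (inside  ∷ q) =
  trans (+-suc _ _) (trans (cong suc (∣p∩q∣+∣p∪q∣≡∣p∣+∣q∣ p q)) (sym (+-suc _ _)))
∣p∩q∣+∣p∪q∣≡∣p∣+∣q∣ (inside  ∷ p) (outside ∷ q) =
  trans (+-suc _ _) (cong suc (∣p∩q∣+∣p∪q∣≡∣p∣+∣q∣ p q))
∣p∩q∣+∣p∪q∣≡∣p∣+∣q∣ (inside  ∷ p) (inside  ∷ q) =
  cong suc (trans (+-suc _ _) (trans (cong suc (∣p∩q∣+∣p∪q∣≡∣p∣+∣q∣ p q)) (sym (+-suc _ _))))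

∩∪-mono-∣∣ : ∀ {n} {p q r s : Subset n} → p ∩ q ⊆ r ∩ s → p ∪ q ⊆ r ∪ s →
             ∣ p ∣ + ∣ q ∣ ≤ ∣ r ∣ + ∣ s ∣
∩∪-mono-∣∣ {p = p} {q} {r} {s} ∩⊆ ∪⊆ =
  subst₂ _≤_ (∣p∩q∣+∣p∪q∣≡∣p∣+∣q∣ p q) (∣p∩q∣+∣p∪q∣≡∣p∣+∣q∣ r s)
    (+-mono-≤ (p⊆q⇒∣p∣≤∣q∣ ∩⊆) (p⊆q⇒∣p∣≤∣q∣ ∪⊆))

injective⇒≤∣p∣ : ∀ {m n} (p : Subset n) (f : Fin m → Fin n) →
                 Injective _≡_ _≡_ f → (∀ i → f i ∈ p) → m ≤ ∣ p ∣
injective⇒≤∣p∣ {0}     p f inj f∈p = z≤n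
injective⇒≤∣p∣ {suc m} p f inj f∈p =
  ≤-trans (s≤s (injective⇒≤∣p∣ (p - f zero) f∘suc (λ e → suc-injective (inj e)) f∘suc∈p-f₀))
          (x∈p⇒∣p-x∣<∣p∣ (f∈p zero))
  where
  f∘suc : Fin m → Fin _
  f∘suc i = f (suc i)
  f∘suc∈p-f₀ : ∀ i → f (suc i) ∈ p - f zero
  f∘suc∈p-f₀ i = x∈p∧x≢y⇒x∈p-y (f∈p (suc i)) (λ e → contradiction (inj e) λ ())

∩-monoˡ-⊆ : ∀ {n} {p q : Subset n} (r : Subset n) → p ⊆ q → p ∩ r ⊆ q ∩ r
∩-monoˡ-⊆ {p = p} r p⊆q x∈p∩r with x∈p∩q⁻ p r x∈p∩r
... | x∈p , x∈r = x∈p∩q⁺ (p⊆q x∈p , x∈r)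

m+n≤k+k∧k≤n⇒m≤k : ∀ {m n k} → m + n ≤ k + k → k ≤ n → m ≤ k
m+n≤k+k∧k≤n⇒m≤k {m} {n} {k} le k≤n = +-cancelʳ-≤ k m k (≤-trans (+-monoʳ-≤ m k≤n) le)

module _ {n : ℕ} (G : Graph n) where

  AdjacentTo : Subset n → Fin n → Set
  AdjacentTo U v = ∃ λ u → u ∈ U × Adjacent G u v

  ∉⇒lookup≡false : ∀ {v} {U : Subset n} → v ∉ U → lookup U v ≡ false
  ∉⇒lookup≡false {v} {U} v∉U with lookup U v in eq
  ... | false = refl
  ... | true  = contradiction (lookup⇒[]= v U eq) v∉U

  anyAdj-sound : ∀ {m} (f : Fin m → Fin n) U v → anyAdj G f U v ≡ true →
                 ∃ λ i → f i ∈ U × Adjacent G (f i) v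
  anyAdj-sound {suc m} f U v h with lookup U (f zero) in eq | adj G (f zero) v in a
  ... | true | true = zero , lookup⇒[]= (f zero) U eq , a
  ... | true | false = let i , p = anyAdj-sound (λ i → f (suc i)) U v h in suc i , p
  ... | false | _ = let i , p = anyAdj-sound (λ i → f (suc i)) U v h in suc i , p

  anyAdj-complete : ∀ {m} (f : Fin m → Fin n) U v i → f i ∈ U → Adjacent G (f i) v →
                    anyAdj G f U v ≡ true
  anyAdj-complete f U v zero    fi∈U a rewrite []=⇒lookup fi∈U | a = refl
  anyAdj-complete f U v (suc i) fi∈U a =
    trans (cong (lookup U (f zero) ∧ adj G (f zero) v ∨_)
                (anyAdj-complete (λ j → f (suc j)) U v i fi∈U a))
          (∨-zeroʳ _)

  ∈Nbh⁺ : ∀ {v U} → v ∉ U → AdjacentTo U v → v ∈ Nbh G U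
  ∈Nbh⁺ {v} {U} v∉U (u , u∈U , uv) = lookup⇒[]= v (Nbh G U) (begin
    lookup (Nbh G U) v                 ≡⟨ lookup∘tabulate _ v ⟩
    not (lookup U v) ∧ anyAdj G id U v ≡⟨ cong (λ b → not b ∧ anyAdj G id U v) (∉⇒lookup≡false v∉U) ⟩
    anyAdj G id U v                    ≡⟨ anyAdj-complete id U v u u∈U uv ⟩
    true                               ∎)
    where open ≡-Reasoning

  ∈Nbh⁻ : ∀ {v U} → v ∈ Nbh G U → v ∉ U × AdjacentTo U v
  ∈Nbh⁻ {v} {U} v∈N with lookup U v in eq | trans (sym (lookup∘tabulate _ v)) ([]=⇒lookup v∈N)
  ... | false | h = (λ v∈U → contradiction (trans (sym ([]=⇒lookup v∈U)) eq) λ ())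
                  , anyAdj-sound id U v h

  ∈Star⁺ : ∀ {v U} → v ∉ U → ¬ AdjacentTo U v → v ∈ Star G U
  ∈Star⁺ {v} {U} v∉U ¬adj = x∉p⇒x∈∁p λ v∈U∪N → case x∈p∪q⁻ U (Nbh G U) v∈U∪N of λ where
    (inj₁ v∈U) → v∉U v∈U
    (inj₂ v∈N) → ¬adj (proj₂ (∈Nbh⁻ v∈N))

  ∈Star⁻ : ∀ {v U} → v ∈ Star G U → v ∉ U × ¬ AdjacentTo U v
  ∈Star⁻ {v} {U} v∈S = v∉U , λ adj → v∉U∪N (x∈p∪q⁺ (inj₂ (∈Nbh⁺ v∉U adj)))
    where
    v∉U∪N : v ∉ U ∪ Nbh G U
    v∉U∪N = x∈∁p⇒x∉p v∈S
    v∉U : v ∉ U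
    v∉U v∈U = v∉U∪N (x∈p∪q⁺ (inj₁ v∈U))

  Star-antitone : ∀ {U W} → U ⊆ W → Star G W ⊆ Star G U
  Star-antitone U⊆W v∈SW with ∈Star⁻ v∈SW
  ... | v∉W , ¬adjW = ∈Star⁺ (v∉W ∘ U⊆W) (λ (u , u∈U , uv) → ¬adjW (u , U⊆W u∈U , uv))

  Star∩Star⊆Star∪ : ∀ U W → Star G U ∩ Star G W ⊆ Star G (U ∪ W)
  Star∩Star⊆Star∪ U W v∈SU∩SW with x∈p∩q⁻ (Star G U) (Star G W) v∈SU∩SW
  ... | v∈SU , v∈SW with ∈Star⁻ v∈SU | ∈Star⁻ v∈SW
  ... | v∉U , ¬adjU | v∉W , ¬adjW = ∈Star⁺ v∉U∪W ¬adjU∪W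
    where
    v∉U∪W : _ ∉ U ∪ W
    v∉U∪W v∈U∪W with x∈p∪q⁻ U W v∈U∪W
    ... | inj₁ v∈U = v∉U v∈U
    ... | inj₂ v∈W = v∉W v∈W
    ¬adjU∪W : ¬ AdjacentTo (U ∪ W) _
    ¬adjU∪W (u , u∈U∪W , uv) with x∈p∪q⁻ U W u∈U∪W
    ... | inj₁ u∈U = ¬adjU (u , u∈U , uv)
    ... | inj₂ u∈W = ¬adjW (u , u∈W , uv)

  Nbh∩∩Nbh∪⊆Nbh∩Nbh : ∀ U W → Nbh G (U ∩ W) ∩ Nbh G (U ∪ W) ⊆ Nbh G U ∩ Nbh G W
  Nbh∩∩Nbh∪⊆Nbh∩Nbh U W v∈ with x∈p∩q⁻ (Nbh G (U ∩ W)) (Nbh G (U ∪ W)) v∈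
  ... | v∈N∩ , v∈N∪ with ∈Nbh⁻ v∈N∩ | ∈Nbh⁻ v∈N∪
  ... | _ , (u , u∈U∩W , uv) | v∉U∪W , _ =
    x∈p∩q⁺ ( ∈Nbh⁺ (v∉U∪W ∘ p⊆p∪q W)   (u , p∩q⊆p U W u∈U∩W , uv)
           , ∈Nbh⁺ (v∉U∪W ∘ q⊆p∪q U W) (u , p∩q⊆q U W u∈U∩W , uv))

  Nbh∩∪Nbh∪⊆Nbh∪Nbh : ∀ U W → Nbh G (U ∩ W) ∪ Nbh G (U ∪ W) ⊆ Nbh G U ∪ Nbh G W
  Nbh∩∪Nbh∪⊆Nbh∪Nbh U W v∈ with x∈p∪q⁻ (Nbh G (U ∩ W)) (Nbh G (U ∪ W)) v∈
  ... | inj₁ v∈N∩ with ∈Nbh⁻ v∈N∩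
  ...   | v∉U∩W , (u , u∈U∩W , uv) with _ ∈? U
  ...     | yes v∈U = x∈p∪q⁺ (inj₂ (∈Nbh⁺ (λ v∈W → v∉U∩W (x∈p∩q⁺ (v∈U , v∈W)))
                                          (u , p∩q⊆q U W u∈U∩W , uv)))
  ...     | no  v∉U = x∈p∪q⁺ (inj₁ (∈Nbh⁺ v∉U (u , p∩q⊆p U W u∈U∩W , uv)))
  Nbh∩∪Nbh∪⊆Nbh∪Nbh U W v∈ | inj₂ v∈N∪ with ∈Nbh⁻ v∈N∪
  ...   | v∉U∪W , (u , u∈U∪W , uv) with x∈p∪q⁻ U W u∈U∪W
  ...     | inj₁ u∈U = x∈p∪q⁺ (inj₁ (∈Nbh⁺ (v∉U∪W ∘ p⊆p∪q W) (u , u∈U , uv)))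
  ...     | inj₂ u∈W = x∈p∪q⁺ (inj₂ (∈Nbh⁺ (v∉U∪W ∘ q⊆p∪q U W) (u , u∈W , uv)))

  Nbh-submodular : ∀ U W → ∣ Nbh G (U ∩ W) ∣ + ∣ Nbh G (U ∪ W) ∣ ≤ ∣ Nbh G U ∣ + ∣ Nbh G W ∣
  Nbh-submodular U W = ∩∪-mono-∣∣ (Nbh∩∩Nbh∪⊆Nbh∩Nbh U W) (Nbh∩∪Nbh∪⊆Nbh∪Nbh U W)

  path-meets-Nbh : ∀ {X s t} xs → Linked (Adjacent G) (s ∷ xs ++ [ t ]) → s ∈ X → t ∈ Star G X →
                   ∃ λ v → v List.∈ xs × v ∈ Nbh G X
  path-meets-Nbh []       (st ∷ _)   s∈X t∈S = contradiction (_ , s∈X , st) (proj₂ (∈Star⁻ t∈S))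
  path-meets-Nbh {X} (y ∷ ys) (sy ∷ path) s∈X t∈S with y ∈? X
  ... | yes y∈X = let v , v∈ys , v∈N = path-meets-Nbh ys path y∈X t∈S in v , there v∈ys , v∈N
  ... | no  y∉X = y , here refl , ∈Nbh⁺ y∉X (_ , s∈X , sy)

  Nbh-separates : ∀ {ℓ X s t} → OpenlyDisjointPaths G ℓ s t → s ∈ X → t ∈ Star G X → ℓ ≤ ∣ Nbh G X ∣
  Nbh-separates {ℓ} {X} (P , paths , disjoint) s∈X t∈S =
    injective⇒≤∣p∣ (Nbh G X) crossing crossing-injective (λ i → proj₂ (proj₂ (meet i)))
    where
    meet : ∀ i → ∃ λ v → v List.∈ lookup P i × v ∈ Nbh G X
    meet i = path-meets-Nbh (lookup P i) (proj₁ (paths i)) s∈X t∈S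
    crossing : Fin ℓ → Fin n
    crossing i = proj₁ (meet i)
    crossing-injective : Injective _≡_ _≡_ crossing
    crossing-injective {i} {j} e = decidable-stable (i ≟ j) λ i≢j →
      disjoint i j i≢j (crossing i) (proj₁ (proj₂ (meet i)))
               (subst (List._∈ lookup P j) (sym e) (proj₁ (proj₂ (meet j))))

  Nbh-lower-bound : ∀ {T ℓ X s t} → Connected G T ℓ → s ∈ T → t ∈ T → s ∈ X → t ∈ Star G X →
                    ℓ ≤ ∣ Nbh G X ∣
  Nbh-lower-bound conn s∈T t∈T s∈X t∈S =
    Nbh-separates (conn _ _ s∈T t∈T λ { refl → proj₁ (∈Star⁻ t∈S) s∈X }) s∈X t∈S

  small-⊆ : ∀ {T X U} → X ⊆ U → ∣ U ∩ T ∣ ≤ ∣ Star G U ∩ T ∣ → ∣ X ∩ T ∣ ≤ ∣ Star G X ∩ T ∣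
  small-⊆ {T} X⊆U small = ≤-trans (p⊆q⇒∣p∣≤∣q∣ (∩-monoˡ-⊆ T X⊆U))
    (≤-trans small (p⊆q⇒∣p∣≤∣q∣ (∩-monoˡ-⊆ T (Star-antitone X⊆U))))

  deficient-∩-∪ : ∀ {T ℓ U W s t} → Connected G T ℓ → Deficient G T ℓ U → Deficient G T ℓ W →
                  s ∈ T → s ∈ U → s ∈ W → t ∈ T → t ∈ Star G U → t ∈ Star G W →
                  Deficient G T ℓ (U ∩ W) × Deficient G T ℓ (U ∪ W)
  deficient-∩-∪ {T} {ℓ} {U} {W} {s} {t} conn (_ , _ , ∣NU∣<) (_ , _ , ∣NW∣<)
                s∈T s∈U s∈W t∈T t∈SU t∈SW =
    ( ((s , x∈p∩q⁺ (s∈∩ , s∈T)) , (t , x∈p∩q⁺ (t∈S∩ , t∈T)) , s≤s ∣N∩∣≤ℓ)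
    , ((s , x∈p∩q⁺ (s∈∪ , s∈T)) , (t , x∈p∩q⁺ (t∈S∪ , t∈T)) , s≤s ∣N∪∣≤ℓ))
    where
    s∈∩ : s ∈ U ∩ W
    s∈∩ = x∈p∩q⁺ (s∈U , s∈W)
    s∈∪ : s ∈ U ∪ W
    s∈∪ = p⊆p∪q W s∈U
    t∈S∩ : t ∈ Star G (U ∩ W)
    t∈S∩ = Star-antitone (p∩q⊆p U W) t∈SU
    t∈S∪ : t ∈ Star G (U ∪ W)
    t∈S∪ = Star∩Star⊆Star∪ U W (x∈p∩q⁺ (t∈SU , t∈SW))
    ∣N∩∣+∣N∪∣≤ℓ+ℓ : ∣ Nbh G (U ∩ W) ∣ + ∣ Nbh G (U ∪ W) ∣ ≤ ℓ + ℓ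
    ∣N∩∣+∣N∪∣≤ℓ+ℓ = ≤-trans (Nbh-submodular U W) (+-mono-≤ (≤-pred ∣NU∣<) (≤-pred ∣NW∣<))
    ∣N∩∣≤ℓ : ∣ Nbh G (U ∩ W) ∣ ≤ ℓ
    ∣N∩∣≤ℓ = m+n≤k+k∧k≤n⇒m≤k ∣N∩∣+∣N∪∣≤ℓ+ℓ (Nbh-lower-bound conn s∈T t∈T s∈∪ t∈S∪)
    ∣N∪∣≤ℓ : ∣ Nbh G (U ∪ W) ∣ ≤ ℓ
    ∣N∪∣≤ℓ = m+n≤k+k∧k≤n⇒m≤k (subst (_≤ ℓ + ℓ) (+-comm ∣ Nbh G (U ∩ W) ∣ _) ∣N∩∣+∣N∪∣≤ℓ+ℓ)
                             (Nbh-lower-bound conn s∈T t∈T s∈∩ t∈S∩)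

lemma7 : {n : ℕ} (G : Graph n) (T : Subset n) (ℓ : ℕ) →
    Connected G T ℓ → 2 * ℓ ≤ ∣ T ∣ → TerminalsIndependent G T →
    (U W : Subset n) → Deficient G T ℓ U → Deficient G T ℓ W → U ≢ W →
    Nonempty (U ∩ W ∩ T) → Nonempty (Star G U ∩ Star G W ∩ T) →
    (Deficient G T ℓ (U ∩ W) × Deficient G T ℓ (U ∪ W)) ×
    (SmallDeficient G T ℓ U ⊎ SmallDeficient G T ℓ W → SmallDeficient G T ℓ (U ∩ W))
lemma7 G T ℓ conn _ _ U W defU defW _ (s , s∈U∩W∩T) (t , t∈SU∩SW∩T)
  with s∈U , s∈W∩T ← x∈p∩q⁻ U (W ∩ T) s∈U∩W∩T
     | t∈SU , t∈SW∩T ← x∈p∩q⁻ (Star G U) (Star G W ∩ T) t∈SU∩SW∩T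
  with s∈W , s∈T ← x∈p∩q⁻ W T s∈W∩T
     | t∈SW , t∈T ← x∈p∩q⁻ (Star G W) T t∈SW∩T
  with deficient-∩ , deficient-∪ ← deficient-∩-∪ G conn defU defW s∈T s∈U s∈W t∈T t∈SU t∈SW
  = (deficient-∩ , deficient-∪) , λ where
      (inj₁ (_ , small)) → deficient-∩ , small-⊆ G (p∩q⊆p U W) small
      (inj₂ (_ , small)) → deficient-∩ , small-⊆ G (p∩q⊆q U W) small
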